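{- Let $d \geq 2$ and let $\mathcal{C}$ be a pure $d$-dimensional $1$-decomposable simplicial complex that is fully coned with respect to $H$, with $|H| \geq d-2$. Let $e$ be an edge between two vertices of $\mathcal{C}$ that is not in $\mathrm{skel}(\mathcal{C})$ and such that the graph $\mathrm{skel}(\mathcal{C})+e$ contains a $(d+1)$-clique using $e$. Let $\mathcal{D}=\mathrm{full}^d(\mathrm{skel}(\mathcal{C})+e)$ (which is fully coned with respect to $H$ and has skeleton $\mathrm{skel}(\mathcal{C})+e$). Then the facets of $\mathcal{D}$ not in $\mathcal{C}$ can be ordered $F_1,\dots,F_t$ so that $\mathcal{C}+\langle F_1,\dots,F_i\rangle$ is $1$-decomposable for every $1\le i\le t$.
   Context: Simplicial complexes, faces, facets, dimension and purity are as usual; $\langle F_1,\dots,F_k\rangle$ is the complex with facets $F_1,\dots,F_k$ and $\mathcal{C}+\langle G_1,\dots,G_k\rangle$ is the complex generated by the facets of $\mathcal{C}$ and $G_1,\dots,G_k$. For a nonempty face $F$: $\mathrm{lk}_F\mathcal{C}=\{G\in\mathcal{C}: G\cap F=\emptyset, G\cup F\in\mathcal{C}\}$, $\mathrm{del}_F\mathcal{C}=\{G\in\mathcal{C}: F\not\subseteq G\}$. A pure $d$-dimensional complex is $k$-decomposable if it is a simplex (one facet), or it has a face $F$ with $\dim F\le k$ such that $\mathrm{del}_F\mathcal{C}$ and $\mathrm{lk}_F\mathcal{C}$ are $k$-decomposable and $\mathrm{del}_F\mathcal{C}$ is pure of dimension $d$. $\mathrm{skel}(\mathcal{C})$ is the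 graph on the vertices of $\mathcal{C}$ whose edges are the $2$-element faces. For a graph $G$, $\mathrm{full}^d(G)$ is the pure $d$-dimensional complex whose facets are all $(d+1)$-cliques of $G$. For $d\ge2$, a pure $d$-dimensional complex $\mathcal{C}$ is fully coned with respect to a subset $H$ of its vertex set if (i) every $h\in H$ is adjacent in $\mathrm{skel}(\mathcal{C})$ to every other vertex, and (ii) every $(d+1)$-clique of $\mathrm{skel}(\mathcal{C})$ is a facet of $\mathcal{C}$. -}

module Defs where

open import Data.Nat using (ℕ; suc; _≤_)
open import Data.Fin using (Fin)
open import Data.Fin.Subset using (Subset; _∈_; _∉_; _⊆_; _∪_; _∩_; ⁅_⁆; ∣_∣; Nonempty; Empty; ⊥)
open import Data.Product using (Σ; ∃; _×_; _,_)
open import Data.Sum using (_⊎_)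
open import Data.List using (List)
open import Data.List.Relation.Unary.Any using (Any)
open import Function.Bundles using (_⇔_)
open import Relation.Binary.PropositionalEquality using (_≡_; _≢_)
open import Relation.Nullary using (¬_)
open import Level using () renaming (suc to lsuc; zero to lzero)

Cx : ℕ → Set₁
Cx n = Subset n → Set

IsComplex : ∀ {n} → Cx n → Set
IsComplex C = ∀ F G → G ⊆ F → C F → C G

Facet : ∀ {n} → Cx n → Subset n → Set
Facet C F = C F × (∀ G → C G → F ⊆ G → F ≡ G)

Pure : ∀ {n} → ℕ → Cx n → Set
Pure d C = ∀ F → Facet C F → ∣ F ∣ ≡ suc d

IsSimplex : ∀ {n} → Cx n → Set
IsSimplex {n} C = Σ (Subset n) λ F → ∀ G → C G ⇔ (G ⊆ F)

del : ∀ {n} → Subset n → Cx n → Cx n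
del F C G = C G × ¬ (F ⊆ G)

lk : ∀ {n} → Subset n → Cx n → Cx n
lk F C G = C G × Empty (G ∩ F) × C (G ∪ F)

data Decomp {n : ℕ} (k : ℕ) : Cx n → Set₁ where
  simplex : ∀ {C} → IsSimplex C → Decomp k C
  shed    : ∀ {C} (d : ℕ) (F : Subset n) → Pure d C → C F → Nonempty F →
            ∣ F ∣ ≤ suc k → Pure d (del F C) →
            Decomp k (del F C) → Decomp k (lk F C) → Decomp k C

Gen : ∀ {n} → Cx n → List (Subset n) → Cx n
Gen C Fs G = C G ⊎ Any (G ⊆_) Fs

record Graph (n : ℕ) : Set₁ where
  field
    vert : Fin n → Set
    adj  : Fin n → Fin n → Set
open Graph public

edge : ∀ {n} → Fin n → Fin n → Subset n
edge u v = ⁅ u ⁆ ∪ ⁅ v ⁆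

Vertex : ∀ {n} → Cx n → Fin n → Set
Vertex C v = C ⁅ v ⁆

skel : ∀ {n} → Cx n → Graph n
skel C = record { vert = Vertex C ; adj = λ x y → x ≢ y × C (edge x y) }

addEdge : ∀ {n} → Graph n → Fin n → Fin n → Graph n
addEdge G u v = record
  { vert = vert G
  ; adj  = λ x y → adj G x y ⊎ ((x ≡ u × y ≡ v) ⊎ (x ≡ v × y ≡ u)) }

Clique : ∀ {n} → Graph n → Subset n → Set
Clique G S = (∀ x → x ∈ S → vert G x) × (∀ x y → x ∈ S → y ∈ S → x ≢ y → adj G x y)

full : ∀ {n} → ℕ → Graph n → Cx n
full {n} d G F = Σ (Subset n) λ S → Clique G S × ∣ S ∣ ≡ suc d × F ⊆ S

FullyConed : ∀ {n} → ℕ → Cx n → Subset n → Set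
FullyConed d C H =
  (∀ h → h ∈ H → Vertex C h × (∀ v → Vertex C v → h ≢ v → C (edge h v))) ×
  (∀ S → Clique (skel C) S → ∣ S ∣ ≡ suc d → Facet C S)

{-# OPTIONS --safe #-}
-- The facets of full^d(skel C + e) missing from C are the sets e ∪ A, with A running over the
-- (d − 1)-cliques of the common neighbourhood V₀ of u and v in skel C. They are added in the order
-- in which these cliques are enumerated by shedding one vertex of V₀ at a time, the vertices of H
-- (adjacent to all of V₀) last. Each prefix complex is 1-decomposable by shedding the edge e: its
-- deletion is C, since a face of e ∪ A missing u or v lies in a d-clique of skel C through a vertex
-- outside H, which is a face of C by full coning and ∣ H ∣ ≥ d − 2; its link is generated by the
-- corresponding prefix of cliques, which is vertex decomposable along the same enumeration.
module Submission where

open import Defs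
open import Data.Nat using (ℕ; zero; suc; _+_; _≤_; _<_; _∸_; z≤n; s≤s)
open import Data.Nat.Properties
  using ( +-suc; +-comm; +-identityʳ; +-monoʳ-≤; +-cancelʳ-≤; ≤-refl; ≤-trans; ≤-reflexive; <⇒≱; n≮n
        ; n≤1+n; m≤n+m; ≤-pred; suc-injective; module ≤-Reasoning)
open import Data.Fin using (Fin; zero; suc) renaming (_≟_ to _≟ᶠ_)
open import Data.Fin.Properties using (¬∀⟶∃¬; any?)
open import Data.Fin.Subset
  using (Subset; inside; outside; _∈_; _∉_; _⊆_; _∪_; _∩_; _─_; _-_; ⁅_⁆; ∣_∣; Nonempty; Empty; ⊥)
open import Data.Fin.Subset.Properties
  using ( _∈?_; _⊆?_; ⊆-refl; ⊆-reflexive; ⊆-trans; ⊆-antisym; ⊥⊆; ∉⊥; drop-∷-Empty; ∣⊥∣≡0; ∣⁅x⁆∣≡1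
        ; x∈⁅x⁆; x∈⁅y⁆⇒x≡y; x≢y⇒x∉⁅y⁆; p⊆q⇒∣p∣≤∣q∣; p⊂q⇒∣p∣<∣q∣; p⊆p∪q; q⊆p∪q; x∈p∪q⁻; p∩q⊆p; p∩q⊆q
        ; x∈p∩q⁺; x∈p∩q⁻; p─q⊆p; ∣p∣≤n; x∈p∧x∉q⇒x∈p─q; x∈p∧x≢y⇒x∈p-y; ∪-comm; ∩-comm)
import Data.Vec.Base as Vec
open import Data.Vec.Base using ([]; _∷_; tabulate)
open import Data.Vec.Properties using ([]=⇒lookup; lookup⇒[]=; lookup∘tabulate)
open import Data.Empty using (⊥-elim)
open import Data.Product using (Σ; ∃; _×_; _,_; proj₁; proj₂)
import Data.Product as Product
open import Data.Sum using (_⊎_; inj₁; inj₂; [_,_]′)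
import Data.Sum as Sum
open import Data.List using (List; []; _∷_; _++_; map; take; length; filter; allFin)
open import Data.List.Properties using (take-map; take-all; length-map)
open import Data.List.Relation.Unary.Any using (Any; here; there)
import Data.List.Relation.Unary.Any as Any
import Data.List.Relation.Unary.Any.Properties as Anyₚ
open import Data.List.Relation.Unary.All using (All; []; _∷_)
import Data.List.Relation.Unary.All as All
import Data.List.Relation.Unary.All.Properties as Allₚ
open import Data.List.Relation.Unary.Unique.Propositional using (Unique)
import Data.List.Relation.Unary.Unique.Propositional.Properties as Unique
open import Data.List.Relation.Unary.AllPairs using ([]; _∷_)
open import Data.List.Membership.Propositional using (find; lose) renaming (_∈_ to _∈L_)
open import Data.List.Membership.Propositional.Properties
  using (∈-map⁺; ∈-map⁻; ∈-++⁻; ∈-++⁺ˡ; ∈-++⁺ʳ; ∈-filter⁺; ∈-filter⁻; ∈-allFin)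
open import Data.List.Relation.Binary.Sublist.Propositional using () renaming (lookup to lookup-⊆)
open import Data.List.Relation.Binary.Sublist.Propositional.Properties using (take-⊆)
open import Function using (_∘_; _$_; id; case_of_)
open import Function.Bundles using (_⇔_; mk⇔; Equivalence)
open import Relation.Binary.PropositionalEquality
  using (_≡_; _≢_; refl; sym; trans; cong; subst; subst₂; module ≡-Reasoning)
open import Relation.Nullary using (¬_; Dec; yes; no; does; contradiction; ¬?)
open import Relation.Nullary.Decidable using (dec-true; _→-dec_; _×-dec_)
open import Relation.Unary using (_≐_; Decidable)
open import Relation.Unary.Properties using (≐-sym)

private variable
  n : ℕ

-- Finite sets

⊈⇒∃∉ : ∀ {p q : Subset n} → ¬ p ⊆ q → ∃ λ x → x ∈ p × x ∉ q
⊈⇒∃∉ {n} {p} {q} p⊈q with ¬∀⟶∃¬ n _ (λ x → x ∈? p →-dec x ∈? q) (λ p⊆q → p⊈q (p⊆q _))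
... | x , x∈p↛x∈q with x ∈? p
...   | yes x∈p = x , x∈p , λ x∈q → x∈p↛x∈q (λ _ → x∈q)
...   | no x∉p  = contradiction (λ x∈p → contradiction x∈p x∉p) x∈p↛x∈q

p⊆q∧∣q∣≤∣p∣⇒p≡q : ∀ {p q : Subset n} → p ⊆ q → ∣ q ∣ ≤ ∣ p ∣ → p ≡ q
p⊆q∧∣q∣≤∣p∣⇒p≡q {p = p} {q} p⊆q ∣q∣≤∣p∣ with q ⊆? p
... | yes q⊆p = ⊆-antisym p⊆q q⊆p
... | no q⊈p  =
  let x , x∈q , x∉p = ⊈⇒∃∉ q⊈p in
  contradiction ∣q∣≤∣p∣ (<⇒≱ (p⊂q⇒∣p∣<∣q∣ (p⊆q , x , x∈q , x∉p)))

∣p∣<∣q∣⇒∃∈q∉p : ∀ {p q : Subset n} → ∣ p ∣ < ∣ q ∣ → ∃ λ x → x ∈ q × x ∉ p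
∣p∣<∣q∣⇒∃∈q∉p {p = p} {q} ∣p∣<∣q∣ with q ⊆? p
... | yes q⊆p = contradiction (p⊆q⇒∣p∣≤∣q∣ q⊆p) (<⇒≱ ∣p∣<∣q∣)
... | no q⊈p  = ⊈⇒∃∉ q⊈p

∣p∣≡0⇒p≡⊥ : ∀ {p : Subset n} → ∣ p ∣ ≡ 0 → p ≡ ⊥
∣p∣≡0⇒p≡⊥ ∣p∣≡0 = sym (p⊆q∧∣q∣≤∣p∣⇒p≡q ⊥⊆ (subst (_≤ _) (sym ∣p∣≡0) z≤n))

∣p∣≡1+k⇒Nonempty : ∀ {p : Subset n} {k} → ∣ p ∣ ≡ suc k → Nonempty p
∣p∣≡1+k⇒Nonempty {n} {p} ∣p∣≡1+k =
  let x , x∈p , _ = ∣p∣<∣q∣⇒∃∈q∉p {p = ⊥} {p} (subst₂ _<_ (sym (∣⊥∣≡0 n)) (sym ∣p∣≡1+k) (s≤s z≤n))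
  in x , x∈p

∣p∪q∣≡∣p∣+∣q∣ : ∀ (p q : Subset n) → Empty (p ∩ q) → ∣ p ∪ q ∣ ≡ ∣ p ∣ + ∣ q ∣
∣p∪q∣≡∣p∣+∣q∣ []            []            _     = refl
∣p∪q∣≡∣p∣+∣q∣ (inside  ∷ p) (inside  ∷ q) p∩q=∅ = contradiction (zero , Vec.here) p∩q=∅
∣p∪q∣≡∣p∣+∣q∣ (inside  ∷ p) (outside ∷ q) p∩q=∅ = cong suc (∣p∪q∣≡∣p∣+∣q∣ p q (drop-∷-Empty p∩q=∅))
∣p∪q∣≡∣p∣+∣q∣ (outside ∷ p) (inside  ∷ q) p∩q=∅ =
  trans (cong suc (∣p∪q∣≡∣p∣+∣q∣ p q (drop-∷-Empty p∩q=∅))) (sym (+-suc _ _))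
∣p∪q∣≡∣p∣+∣q∣ (outside ∷ p) (outside ∷ q) p∩q=∅ = ∣p∪q∣≡∣p∣+∣q∣ p q (drop-∷-Empty p∩q=∅)

∣p∣≡∣p─q∣+∣p∩q∣ : ∀ (p q : Subset n) → ∣ p ∣ ≡ ∣ p ─ q ∣ + ∣ p ∩ q ∣
∣p∣≡∣p─q∣+∣p∩q∣ []            []            = refl
∣p∣≡∣p─q∣+∣p∩q∣ (inside  ∷ p) (inside  ∷ q) =
  trans (cong suc (∣p∣≡∣p─q∣+∣p∩q∣ p q)) (sym (+-suc _ _))
∣p∣≡∣p─q∣+∣p∩q∣ (inside  ∷ p) (outside ∷ q) = cong suc (∣p∣≡∣p─q∣+∣p∩q∣ p q)
∣p∣≡∣p─q∣+∣p∩q∣ (outside ∷ p) (inside  ∷ q) = ∣p∣≡∣p─q∣+∣p∩q∣ p q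
∣p∣≡∣p─q∣+∣p∩q∣ (outside ∷ p) (outside ∷ q) = ∣p∣≡∣p─q∣+∣p∩q∣ p q

x∈p─q⇒x∉q : ∀ {x} (p q : Subset n) → x ∈ p ─ q → x ∉ q
x∈p─q⇒x∉q (_ ∷ p) (inside  ∷ q) (Vec.there x∈) (Vec.there x∈q) = x∈p─q⇒x∉q p q x∈ x∈q
x∈p─q⇒x∉q (_ ∷ p) (outside ∷ q) (Vec.there x∈) (Vec.there x∈q) = x∈p─q⇒x∉q p q x∈ x∈q

Empty[p─q∩q] : ∀ (p q : Subset n) → Empty ((p ─ q) ∩ q)
Empty[p─q∩q] p q (x , x∈) = let x∈p─q , x∈q = x∈p∩q⁻ (p ─ q) q x∈ in x∈p─q⇒x∉q p q x∈p─q x∈q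

Empty-∩-comm : ∀ {p q : Subset n} → Empty (p ∩ q) → Empty (q ∩ p)
Empty-∩-comm {p = p} {q} = subst Empty (∩-comm p q)

x∈p-y⇒x≢y : ∀ {x y} {p : Subset n} → x ∈ p - y → x ≢ y
x∈p-y⇒x≢y {y = y} {p} x∈ refl = x∈p─q⇒x∉q p ⁅ y ⁆ x∈ (x∈⁅x⁆ y)

x∉p-x : ∀ {x} {p : Subset n} → x ∉ p - x
x∉p-x x∈ = x∈p-y⇒x≢y x∈ refl

x∈p⇒⁅x⁆⊆p : ∀ {x} {p : Subset n} → x ∈ p → ⁅ x ⁆ ⊆ p
x∈p⇒⁅x⁆⊆p {x = x} {p} x∈p y∈⁅x⁆ = subst (_∈ p) (sym (x∈⁅y⁆⇒x≡y x y∈⁅x⁆)) x∈p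

∪-lub : ∀ {p q r : Subset n} → p ⊆ r → q ⊆ r → p ∪ q ⊆ r
∪-lub {p = p} {q} p⊆r q⊆r x∈ = [ p⊆r , q⊆r ]′ (x∈p∪q⁻ p q x∈)

x∈⁅y⁆∪p⁻ : ∀ {x} (y : Fin n) (p : Subset n) → x ∈ ⁅ y ⁆ ∪ p → x ≡ y ⊎ x ∈ p
x∈⁅y⁆∪p⁻ y p x∈ = Sum.map₁ (x∈⁅y⁆⇒x≡y y) (x∈p∪q⁻ ⁅ y ⁆ p x∈)

x∉p⇒Empty[p∩⁅x⁆] : ∀ {x} {p : Subset n} → x ∉ p → Empty (p ∩ ⁅ x ⁆)
x∉p⇒Empty[p∩⁅x⁆] {x = x} {p} x∉p (y , y∈) =
  let y∈p , y∈⁅x⁆ = x∈p∩q⁻ p ⁅ x ⁆ y∈ in x∉p (subst (_∈ p) (x∈⁅y⁆⇒x≡y x y∈⁅x⁆) y∈p)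

∣⁅x⁆∪p∣≡1+∣p∣ : ∀ {x} {p : Subset n} → x ∉ p → ∣ ⁅ x ⁆ ∪ p ∣ ≡ suc ∣ p ∣
∣⁅x⁆∪p∣≡1+∣p∣ {x = x} {p} x∉p = begin
  ∣ ⁅ x ⁆ ∪ p ∣     ≡⟨ cong ∣_∣ (∪-comm ⁅ x ⁆ p) ⟩
  ∣ p ∪ ⁅ x ⁆ ∣     ≡⟨ ∣p∪q∣≡∣p∣+∣q∣ p ⁅ x ⁆ (x∉p⇒Empty[p∩⁅x⁆] x∉p) ⟩
  ∣ p ∣ + ∣ ⁅ x ⁆ ∣ ≡⟨ cong (∣ p ∣ +_) (∣⁅x⁆∣≡1 x) ⟩
  ∣ p ∣ + 1         ≡⟨ +-comm ∣ p ∣ 1 ⟩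
  suc ∣ p ∣         ∎
  where open ≡-Reasoning

⁅x⁆∪[p-x]≡p : ∀ {x} {p : Subset n} → x ∈ p → ⁅ x ⁆ ∪ (p - x) ≡ p
⁅x⁆∪[p-x]≡p {x = x} {p} x∈p = ⊆-antisym (∪-lub (x∈p⇒⁅x⁆⊆p x∈p) (p─q⊆p p ⁅ x ⁆)) included
  where
  included : p ⊆ ⁅ x ⁆ ∪ (p - x)
  included {y} y∈p with y ≟ᶠ x
  ... | yes refl = p⊆p∪q (p - x) (x∈⁅x⁆ x)
  ... | no y≢x   = q⊆p∪q ⁅ x ⁆ (p - x) (x∈p∧x≢y⇒x∈p-y y∈p y≢x)

∣p∣≡1+∣p-x∣ : ∀ {x} {p : Subset n} → x ∈ p → ∣ p ∣ ≡ suc ∣ p - x ∣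
∣p∣≡1+∣p-x∣ {x = x} {p} x∈p =
  trans (cong ∣_∣ (sym (⁅x⁆∪[p-x]≡p x∈p))) (∣⁅x⁆∪p∣≡1+∣p∣ {p = p - x} x∉p-x)

∪-cancelˡ : ∀ (r : Subset n) {p q} → Empty (p ∩ r) → Empty (q ∩ r) → r ∪ p ≡ r ∪ q → p ≡ q
∪-cancelˡ r p∩r=∅ q∩r=∅ r∪p≡r∪q = ⊆-antisym (included p∩r=∅ r∪p≡r∪q) (included q∩r=∅ (sym r∪p≡r∪q))
  where
  included : ∀ {p q} → Empty (p ∩ r) → r ∪ p ≡ r ∪ q → p ⊆ q
  included {p} {q} p∩r=∅ r∪p≡r∪q x∈p with x∈p∪q⁻ r q (subst (_ ∈_) r∪p≡r∪q (q⊆p∪q r p x∈p))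
  ... | inj₁ x∈r = contradiction (_ , x∈p∩q⁺ (x∈p , x∈r)) p∩r=∅
  ... | inj₂ x∈q = x∈q

p⊆q⇒p∪[q─p]≡q : ∀ {p q : Subset n} → p ⊆ q → p ∪ (q ─ p) ≡ q
p⊆q⇒p∪[q─p]≡q {p = p} {q} p⊆q = ⊆-antisym (∪-lub p⊆q (p─q⊆p q p)) included
  where
  included : q ⊆ p ∪ (q ─ p)
  included {x} x∈q with x ∈? p
  ... | yes x∈p = p⊆p∪q (q ─ p) x∈p
  ... | no x∉p  = q⊆p∪q p (q ─ p) (x∈p∧x∉q⇒x∈p─q x∈q x∉p)

x∈edge⁻ : ∀ {x u v : Fin n} → x ∈ edge u v → x ≡ u ⊎ x ≡ v
x∈edge⁻ {u = u} {v} x∈ = Sum.map (x∈⁅y⁆⇒x≡y u) (x∈⁅y⁆⇒x≡y v) (x∈p∪q⁻ ⁅ u ⁆ ⁅ v ⁆ x∈)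

u∈edge : ∀ {u v : Fin n} → u ∈ edge u v
u∈edge {u = u} {v} = p⊆p∪q ⁅ v ⁆ (x∈⁅x⁆ u)

v∈edge : ∀ {u v : Fin n} → v ∈ edge u v
v∈edge {u = u} {v} = q⊆p∪q ⁅ u ⁆ ⁅ v ⁆ (x∈⁅x⁆ v)

∣edge∣≡2 : ∀ {u v : Fin n} → u ≢ v → ∣ edge u v ∣ ≡ 2
∣edge∣≡2 {v = v} u≢v = trans (∣⁅x⁆∪p∣≡1+∣p∣ (x≢y⇒x∉⁅y⁆ u≢v)) (cong suc (∣⁅x⁆∣≡1 v))

select : {P : Fin n → Set} → Decidable P → Subset n
select P? = tabulate (does ∘ P?)

∈-select⁺ : ∀ {P : Fin n → Set} (P? : Decidable P) {x} → P x → x ∈ select P?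
∈-select⁺ P? {x} Px = lookup⇒[]= x _ (trans (lookup∘tabulate (does ∘ P?) x) (dec-true (P? x) Px))

∈-select⁻ : ∀ {P : Fin n → Set} (P? : Decidable P) {x} → x ∈ select P? → P x
∈-select⁻ P? {x} x∈ with P? x | trans (sym (lookup∘tabulate (does ∘ P?) x)) ([]=⇒lookup x∈)
... | yes Px | _ = Px
... | no _   | ()

take-head : ∀ {A : Set} {j} (xs : List A) → 1 ≤ j → j ≤ length xs → ∃ λ x → x ∈L take j xs
take-head {j = suc _} (x ∷ _) _ _ = x , here refl

Unique-map⁺-on : ∀ {A B : Set} {P : A → Set} (f : A → B) →
  (∀ {x y} → P x → P y → f x ≡ f y → x ≡ y) → ∀ {xs} → All P xs → Unique xs → Unique (map f xs)
Unique-map⁺-on f inj [] [] = []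
Unique-map⁺-on f inj (px ∷ pxs) (x∉xs ∷ unique) =
  Allₚ.map⁺ (All.zipWith (λ (py , x≢y) fx≡fy → x≢y (inj px py fx≡fy)) (pxs , x∉xs))
  ∷ Unique-map⁺-on f inj pxs unique

-- Complexes

Facet-resp-≐ : ∀ {C C′ : Cx n} {F} → C ≐ C′ → Facet C F → Facet C′ F
Facet-resp-≐ (C⊆C′ , C′⊆C) (CF , maximal) = C⊆C′ CF , λ G C′G F⊆G → maximal G (C′⊆C C′G) F⊆G

Pure-resp-≐ : ∀ {d} {C C′ : Cx n} → C ≐ C′ → Pure d C → Pure d C′
Pure-resp-≐ C≐C′ pure F facet = pure F (Facet-resp-≐ (≐-sym C≐C′) facet)

del-resp-≐ : ∀ F {C C′ : Cx n} → C ≐ C′ → del F C ≐ del F C′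
del-resp-≐ F (C⊆C′ , C′⊆C) = Product.map₁ C⊆C′ , Product.map₁ C′⊆C

lk-resp-≐ : ∀ F {C C′ : Cx n} → C ≐ C′ → lk F C ≐ lk F C′
lk-resp-≐ F (C⊆C′ , C′⊆C) =
  Product.map C⊆C′ (Product.map₂ C⊆C′) , Product.map C′⊆C (Product.map₂ C′⊆C)

Decomp-resp-≐ : ∀ {k} {C C′ : Cx n} → C ≐ C′ → Decomp k C → Decomp k C′
Decomp-resp-≐ (C⊆C′ , C′⊆C) (simplex (F , faces)) =
  simplex (F , λ G → mk⇔ {B = G ⊆ F} (λ C′G → Equivalence.to (faces G) (C′⊆C C′G))
                                     (λ (G⊆F : G ⊆ F) → C⊆C′ (Equivalence.from (faces G) G⊆F)))
Decomp-resp-≐ C≐C′ (shed d F pure CF F≢∅ ∣F∣≤ pureDel decDel decLk) =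
  shed d F (Pure-resp-≐ C≐C′ pure) (proj₁ C≐C′ CF) F≢∅ ∣F∣≤
       (Pure-resp-≐ (del-resp-≐ F C≐C′) pureDel)
       (Decomp-resp-≐ (del-resp-≐ F C≐C′) decDel)
       (Decomp-resp-≐ (lk-resp-≐ F C≐C′) decLk)

vertex-of-face : ∀ {C : Cx n} {F x} → IsComplex C → C F → x ∈ F → Vertex C x
vertex-of-face isC CF x∈F = isC _ _ (x∈p⇒⁅x⁆⊆p x∈F) CF

edge-of-face : ∀ {C : Cx n} {F x y} → IsComplex C → C F → x ∈ F → y ∈ F → C (edge x y)
edge-of-face isC CF x∈F y∈F = isC _ _ (∪-lub (x∈p⇒⁅x⁆⊆p x∈F) (x∈p⇒⁅x⁆⊆p y∈F)) CF

module _ {C : Cx n} (isC : IsComplex C) (C? : ∀ F → Dec (C F)) where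

  private
    extension? : ∀ G → Dec (∃ λ x → x ∉ G × C (⁅ x ⁆ ∪ G))
    extension? G = any? λ x → ¬? (x ∈? G) ×-dec C? (⁅ x ⁆ ∪ G)

    climb : ∀ fuel {G} → n ≤ ∣ G ∣ + fuel → C G → ∃ λ T → Facet C T × G ⊆ T
    climb fuel {G} n≤ CG with extension? G
    ... | no unextendable = G , (CG , maximal) , id
      where
      maximal : ∀ G′ → C G′ → G ⊆ G′ → G ≡ G′
      maximal G′ CG′ G⊆G′ with G′ ⊆? G
      ... | yes G′⊆G = ⊆-antisym G⊆G′ G′⊆G
      ... | no G′⊈G  =
        let x , x∈G′ , x∉G = ⊈⇒∃∉ G′⊈G in
        contradiction (x , x∉G , isC G′ _ (∪-lub (x∈p⇒⁅x⁆⊆p x∈G′) G⊆G′) CG′) unextendable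
    climb zero {G} n≤ CG | yes (x , x∉G , _) =
      contradiction (begin
        suc ∣ G ∣        ≡⟨ ∣⁅x⁆∪p∣≡1+∣p∣ x∉G ⟨
        ∣ ⁅ x ⁆ ∪ G ∣   ≤⟨ ∣p∣≤n (⁅ x ⁆ ∪ G) ⟩
        n               ≤⟨ n≤ ⟩
        ∣ G ∣ + 0        ≡⟨ +-identityʳ ∣ G ∣ ⟩
        ∣ G ∣            ∎) (n≮n ∣ G ∣)
      where open ≤-Reasoning
    climb (suc fuel) {G} n≤ CG | yes (x , x∉G , C[x∪G]) =
      let n≤′ = subst (n ≤_) (trans (+-suc ∣ G ∣ fuel) (cong (_+ fuel) (sym (∣⁅x⁆∪p∣≡1+∣p∣ x∉G)))) n≤
          T , facet , x∪G⊆T = climb fuel n≤′ C[x∪G]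
      in T , facet , λ y∈G → x∪G⊆T (q⊆p∪q ⁅ x ⁆ G y∈G)

  facet-above : ∀ {G} → C G → ∃ λ T → Facet C T × G ⊆ T
  facet-above {G} = climb n (m≤n+m n ∣ G ∣)

⟨_⟩ : List (Subset n) → Cx n
⟨ Fs ⟩ G = Any (G ⊆_) Fs

⟨⟩-pure : ∀ {d} {Fs : List (Subset n)} → All (λ F → ∣ F ∣ ≡ suc d) Fs → Pure d ⟨ Fs ⟩
⟨⟩-pure sizes F (F⊆ , maximal) =
  let Fᵢ , Fᵢ∈ , F⊆Fᵢ = find F⊆ in
  trans (cong ∣_∣ (maximal Fᵢ (lose Fᵢ∈ ⊆-refl) F⊆Fᵢ)) (All.lookup sizes Fᵢ∈)

Gen-pure : ∀ {d} {C : Cx n} {Fs} → Pure d C → Pure d ⟨ Fs ⟩ → Pure d (Gen C Fs)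
Gen-pure pureC _     F (inj₁ CF , maximal) = pureC F (CF , λ G CG → maximal G (inj₁ CG))
Gen-pure _     pureFs F (inj₂ F⊆ , maximal) = pureFs F (F⊆ , λ G G⊆ → maximal G (inj₂ G⊆))

⟨⟩-simplex : ∀ {F} {Fs : List (Subset n)} → F ∈L Fs → All (_≡ F) Fs → IsSimplex ⟨ Fs ⟩
⟨⟩-simplex {F = F} {Fs} F∈ all≡F = F , λ G → mk⇔ {B = G ⊆ F} (below-F G) (lose F∈)
  where
  below-F : ∀ G → ⟨ Fs ⟩ G → G ⊆ F
  below-F G G⊆ with find G⊆
  ... | Fᵢ , Fᵢ∈ , G⊆Fᵢ = subst (G ⊆_) (All.lookup all≡F Fᵢ∈) G⊆Fᵢ

⟨⟩-isComplex : ∀ {Fs : List (Subset n)} → IsComplex ⟨ Fs ⟩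
⟨⟩-isComplex F G G⊆F = Any.map {P = F ⊆_} {Q = G ⊆_} (λ F⊆Fᵢ → ⊆-trans G⊆F F⊆Fᵢ)

⟨++⟩≐Gen : ∀ (xs ys : List (Subset n)) → ⟨ xs ++ ys ⟩ ≐ Gen ⟨ xs ⟩ ys
⟨++⟩≐Gen xs ys = Anyₚ.++⁻ xs , [ Anyₚ.++⁺ˡ , Anyₚ.++⁺ʳ xs ]′

module _ (F : Subset n) (X : Cx n) (P : List (Subset n)) (F∉X : ∀ {G} → X G → ¬ F ⊆ G) where

  private
    Cone : Cx n
    Cone = Gen X (map (F ∪_) P)

  del-cone : (∀ {B G} → B ∈L P → G ⊆ F ∪ B → ¬ F ⊆ G → X G) → del F Cone ≐ X
  del-cone faces = to , λ XG → inj₁ XG , F∉X XG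
    where
    to : ∀ {G} → del F Cone G → X G
    to (inj₁ XG , _) = XG
    to (inj₂ G⊆ , F⊈G) = let B , B∈ , G⊆F∪B = find (Anyₚ.map⁻ G⊆) in faces B∈ G⊆F∪B F⊈G

  lk-cone : All (λ B → Empty (B ∩ F)) P → lk F Cone ≐ ⟨ P ⟩
  lk-cone disjoint = to , from
    where
    to : ∀ {G} → lk F Cone G → ⟨ P ⟩ G
    to {G} (_ , _ , inj₁ X[G∪F]) = ⊥-elim (F∉X X[G∪F] (q⊆p∪q G F))
    to {G} (_ , G∩F=∅ , inj₂ G∪F⊆) =
      let B , B∈ , G∪F⊆F∪B = find (Anyₚ.map⁻ G∪F⊆) in
      lose B∈ λ x∈G → case x∈p∪q⁻ F B (G∪F⊆F∪B (p⊆p∪q F x∈G)) of λ where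
        (inj₁ x∈F) → contradiction (_ , x∈p∩q⁺ (x∈G , x∈F)) G∩F=∅
        (inj₂ x∈B) → x∈B
    from : ∀ {G} → ⟨ P ⟩ G → lk F Cone G
    from {G} G⊆ =
      let B , B∈ , G⊆B = find G⊆
          G⊆F∪B : G ⊆ F ∪ B
          G⊆F∪B x∈G = q⊆p∪q F B (G⊆B x∈G)
      in inj₂ (Anyₚ.map⁺ (lose B∈ G⊆F∪B))
       , (λ (x , x∈) → let x∈G , x∈F = x∈p∩q⁻ G F x∈ in
                       All.lookup disjoint B∈ (x , x∈p∩q⁺ (G⊆B x∈G , x∈F)))
       , inj₂ (Anyₚ.map⁺ (lose B∈ (∪-lub G⊆F∪B (p⊆p∪q B))))

  Decomp-cone : ∀ {m d B₀} → Nonempty F → ∣ F ∣ ≤ suc m → B₀ ∈L P →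
    (∀ {B G} → B ∈L P → G ⊆ F ∪ B → ¬ F ⊆ G → X G) →
    All (λ B → Empty (B ∩ F)) P → All (λ B → ∣ F ∪ B ∣ ≡ suc d) P →
    Pure d X → Decomp m X → Decomp m ⟨ P ⟩ → Decomp m Cone
  Decomp-cone {d = d} {B₀} F≢∅ ∣F∣≤ B₀∈ faces disjoint sizes pureX decX decP =
    shed d F (Gen-pure pureX (⟨⟩-pure (Allₚ.map⁺ sizes)))
           (inj₂ (Anyₚ.map⁺ (lose B₀∈ (p⊆p∪q B₀)))) F≢∅ ∣F∣≤
           (Pure-resp-≐ (≐-sym del≐X) pureX)
           (Decomp-resp-≐ (≐-sym del≐X) decX)
           (Decomp-resp-≐ (≐-sym (lk-cone disjoint)) decP)
    where
    del≐X : del F Cone ≐ X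
    del≐X = del-cone faces

PrefixDecomposable : ℕ → (List (Subset n) → Cx n) → List (Subset n) → Set₁
PrefixDecomposable k K Fs = ∀ i → 1 ≤ i → i ≤ length Fs → Decomp k (K (take i Fs))

PrefixDecomposable-++ : ∀ {k} {K : List (Subset n) → Cx n} {xs ys} →
  PrefixDecomposable k K xs → PrefixDecomposable k (K ∘ (xs ++_)) ys →
  PrefixDecomposable k K (xs ++ ys)
PrefixDecomposable-++ {xs = []} _ dec-ys i 1≤i i≤ = dec-ys i 1≤i i≤
PrefixDecomposable-++ {xs = _ ∷ _} dec-xs _ 1 _ _ = dec-xs 1 ≤-refl (s≤s z≤n)
PrefixDecomposable-++ {K = K} {x ∷ xs} dec-xs dec-ys (suc (suc i)) _ (s≤s i≤) =
  PrefixDecomposable-++ {K = K ∘ (x ∷_)} {xs}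
    (λ i 1≤i i≤ → dec-xs (suc i) (s≤s z≤n) (s≤s i≤)) dec-ys (suc i) (s≤s z≤n) i≤

PrefixDecomposable-map : ∀ {k k′} {K K′ : List (Subset n) → Cx n} {f : Subset n → Subset n} {xs} →
  (∀ P {x₀} → x₀ ∈L P → (∀ {x} → x ∈L P → x ∈L xs) → Decomp k (K P) → Decomp k′ (K′ (map f P))) →
  PrefixDecomposable k K xs → PrefixDecomposable k′ K′ (map f xs)
PrefixDecomposable-map {k′ = k′} {K′ = K′} {f} {xs} step dec i 1≤i i≤ =
  let i≤∣xs∣ = subst (i ≤_) (length-map f xs) i≤
      x₀∈ = proj₂ (take-head xs 1≤i i≤∣xs∣)
  in subst (Decomp k′ ∘ K′) (sym (take-map i xs))
       (step (take i xs) x₀∈ (lookup-⊆ (take-⊆ i xs)) (dec i 1≤i i≤∣xs∣))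

module _ {m k : ℕ} (w : Fin n) where

  Decomp-++-cone : ∀ Q₁ P {B₀} → B₀ ∈L P →
    (∀ {A} → A ∈L Q₁ → w ∉ A × ∣ A ∣ ≡ suc k) → (∀ {B} → B ∈L P → w ∉ B × ∣ B ∣ ≡ k) →
    (∀ {A B} → A ∈L Q₁ → B ∈L P → ⟨ Q₁ ⟩ B) → (Q₁ ≡ [] → ∀ {B B′} → B ∈L P → B′ ∈L P → B ≡ B′) →
    PrefixDecomposable m ⟨_⟩ Q₁ → Decomp m ⟨ P ⟩ → Decomp m ⟨ Q₁ ++ map (⁅ w ⁆ ∪_) P ⟩
  Decomp-++-cone [] P B₀∈ _ _ _ unique _ _ =
    simplex (⟨⟩-simplex (∈-map⁺ (⁅ w ⁆ ∪_) B₀∈)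
                        (Allₚ.map⁺ (All.tabulate λ B∈ → cong (⁅ w ⁆ ∪_) (unique refl B∈ B₀∈))))
  Decomp-++-cone Q₁@(_ ∷ _) P B₀∈ Q₁-avoids P-avoids extends _ dec₁ decP =
    Decomp-resp-≐ (≐-sym (⟨++⟩≐Gen Q₁ _))
      (Decomp-cone ⁅ w ⁆ ⟨ Q₁ ⟩ P ⁅w⁆∉⟨Q₁⟩ (w , x∈⁅x⁆ w) ∣⁅w⁆∣≤1+m B₀∈ faces
        (All.tabulate λ B∈ → x∉p⇒Empty[p∩⁅x⁆] (proj₁ (P-avoids B∈)))
        (All.tabulate λ B∈ → let w∉B , ∣B∣≡k = P-avoids B∈ in trans (∣⁅x⁆∪p∣≡1+∣p∣ w∉B) (cong suc ∣B∣≡k))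
        (⟨⟩-pure (All.tabulate (proj₂ ∘ Q₁-avoids)))
        (subst (Decomp m ∘ ⟨_⟩) (take-all (length Q₁) Q₁ ≤-refl)
               (dec₁ (length Q₁) (s≤s z≤n) ≤-refl))
        decP)
    where
    ⁅w⁆∉⟨Q₁⟩ : ∀ {G} → ⟨ Q₁ ⟩ G → ¬ ⁅ w ⁆ ⊆ G
    ⁅w⁆∉⟨Q₁⟩ G⊆ ⁅w⁆⊆G with find G⊆
    ... | A , A∈ , G⊆A = proj₁ (Q₁-avoids A∈) (G⊆A (⁅w⁆⊆G (x∈⁅x⁆ w)))

    ∣⁅w⁆∣≤1+m : ∣ ⁅ w ⁆ ∣ ≤ suc m
    ∣⁅w⁆∣≤1+m = subst (_≤ suc m) (sym (∣⁅x⁆∣≡1 w)) (s≤s z≤n)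

    faces : ∀ {B G} → B ∈L P → G ⊆ ⁅ w ⁆ ∪ B → ¬ ⁅ w ⁆ ⊆ G → ⟨ Q₁ ⟩ G
    faces {B} {G} B∈ G⊆w∪B ⁅w⁆⊈G = ⟨⟩-isComplex B G G⊆B (extends (here refl) B∈)
      where
      G⊆B : G ⊆ B
      G⊆B x∈G with x∈⁅y⁆∪p⁻ w B (G⊆w∪B x∈G)
      ... | inj₁ refl = ⊥-elim (⁅w⁆⊈G (x∈p⇒⁅x⁆⊆p x∈G))
      ... | inj₂ x∈B  = x∈B

  PrefixDecomposable-++-cone : ∀ Q₁ Q₂ →
    (∀ {A} → A ∈L Q₁ → w ∉ A × ∣ A ∣ ≡ suc k) → (∀ {B} → B ∈L Q₂ → w ∉ B × ∣ B ∣ ≡ k) →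
    (∀ {A B} → A ∈L Q₁ → B ∈L Q₂ → ⟨ Q₁ ⟩ B) → (Q₁ ≡ [] → ∀ {B B′} → B ∈L Q₂ → B′ ∈L Q₂ → B ≡ B′) →
    PrefixDecomposable m ⟨_⟩ Q₁ → PrefixDecomposable m ⟨_⟩ Q₂ →
    PrefixDecomposable m ⟨_⟩ (Q₁ ++ map (⁅ w ⁆ ∪_) Q₂)
  PrefixDecomposable-++-cone Q₁ Q₂ Q₁-avoids Q₂-avoids extends unique dec₁ dec₂ =
    PrefixDecomposable-++ {K = ⟨_⟩} {Q₁} dec₁
      (PrefixDecomposable-map {K′ = ⟨_⟩ ∘ (Q₁ ++_)} (λ P B₀∈ ⊆Q₂ →
         Decomp-++-cone Q₁ P B₀∈ Q₁-avoids (Q₂-avoids ∘ ⊆Q₂) (λ A∈ B∈ → extends A∈ (⊆Q₂ B∈))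
           (λ Q₁≡[] B∈ B′∈ → unique Q₁≡[] (⊆Q₂ B∈) (⊆Q₂ B′∈)) dec₁)
         dec₂)

-- Graphs

Clique-⊆ : ∀ {G : Graph n} {R K} → R ⊆ K → Clique G K → Clique G R
Clique-⊆ R⊆K (vert , adjacent) =
  (λ x x∈R → vert x (R⊆K x∈R)) , λ x y x∈R y∈R → adjacent x y (R⊆K x∈R) (R⊆K y∈R)

full-facet : ∀ {d} {G : Graph n} {S} → Clique G S → ∣ S ∣ ≡ suc d → Facet (full d G) S
full-facet {S = S} S-clique size = (S , S-clique , size , ⊆-refl) , maximal
  where
  maximal : ∀ F → full _ _ F → S ⊆ F → S ≡ F
  maximal F (S′ , _ , size′ , F⊆S′) S⊆F =
    let S≡S′ = p⊆q∧∣q∣≤∣p∣⇒p≡q (λ x∈S → F⊆S′ (S⊆F x∈S)) (≤-reflexive (trans size′ (sym size))) in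
    ⊆-antisym S⊆F λ x∈F → subst (_ ∈_) (sym S≡S′) (F⊆S′ x∈F)

full-facet⁻ : ∀ {d} {G : Graph n} {S} → Facet (full d G) S → Clique G S × ∣ S ∣ ≡ suc d
full-facet⁻ ((S′ , S′-clique , size′ , S⊆S′) , maximal)
  with maximal S′ (S′ , S′-clique , size′ , ⊆-refl) S⊆S′
... | refl = S′-clique , size′

adj-addEdge⁻ : ∀ {G : Graph n} {u v x y} → adj (addEdge G u v) x y →
               x ∉ edge u v ⊎ y ∉ edge u v → adj G x y
adj-addEdge⁻ (inj₁ xy) _ = xy
adj-addEdge⁻ (inj₂ (inj₁ (refl , refl))) off-edge = ⊥-elim ([ _$ u∈edge , _$ v∈edge ]′ off-edge)
adj-addEdge⁻ (inj₂ (inj₂ (refl , refl))) off-edge = ⊥-elim ([ _$ v∈edge , _$ u∈edge ]′ off-edge)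

Clique-addEdge⁻ : ∀ {G : Graph n} {u v S} →
                  Clique (addEdge G u v) S → ¬ (u ∈ S × v ∈ S) → Clique G S
Clique-addEdge⁻ (vert , adjacent) not-both = vert , λ x y x∈S y∈S x≢y →
  case adjacent x y x∈S y∈S x≢y of λ where
    (inj₁ xy)                   → xy
    (inj₂ (inj₁ (refl , refl))) → ⊥-elim (not-both (x∈S , y∈S))
    (inj₂ (inj₂ (refl , refl))) → ⊥-elim (not-both (y∈S , x∈S))

-- Cliques

module Cliques {n} (_~_ : Fin n → Fin n → Set) (_~?_ : ∀ x y → Dec (x ~ y))
               (~-sym : ∀ {x y} → x ~ y → y ~ x) where

  N : Fin n → Subset n
  N w = select (w ~?_)

  neighbours : Subset n → Fin n → Subset n
  neighbours V w = (V - w) ∩ N w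

  neighbours⊆V : ∀ {V w} → neighbours V w ⊆ V
  neighbours⊆V x∈ = p─q⊆p _ _ (p∩q⊆p _ _ x∈)

  w∉neighbours : ∀ {V w} → w ∉ neighbours V w
  w∉neighbours w∈ = x∉p-x (p∩q⊆p _ _ w∈)

  IsClique : Subset n → Set
  IsClique B = ∀ x y → x ∈ B → y ∈ B → x ≢ y → x ~ y

  ⁅x⁆∪-IsClique : ∀ {x B} → IsClique B → (∀ y → y ∈ B → x ~ y) → IsClique (⁅ x ⁆ ∪ B)
  ⁅x⁆∪-IsClique {x} {B} clique x~B y z y∈ z∈ y≢z with x∈⁅y⁆∪p⁻ x B y∈ | x∈⁅y⁆∪p⁻ x B z∈
  ... | inj₁ refl | inj₁ refl = contradiction refl y≢z
  ... | inj₁ refl | inj₂ z∈B = x~B z z∈B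
  ... | inj₂ y∈B  | inj₁ refl = ~-sym (x~B y y∈B)
  ... | inj₂ y∈B  | inj₂ z∈B = clique y z y∈B z∈B y≢z

  record KClique (V : Subset n) (k : ℕ) (B : Subset n) : Set where
    field
      ⊆V     : B ⊆ V
      clique : IsClique B
      size   : ∣ B ∣ ≡ k

  open KClique

  KClique-mono : ∀ {V V′ k B} → V ⊆ V′ → KClique V k B → KClique V′ k B
  KClique-mono V⊆V′ B = record { ⊆V = λ x∈B → V⊆V′ (⊆V B x∈B) ; clique = clique B ; size = size B }

  KClique-extend : ∀ {V k B x} → x ∈ V → x ∉ B → (∀ y → y ∈ B → x ~ y) →
                   KClique V k B → KClique V (suc k) (⁅ x ⁆ ∪ B)
  KClique-extend x∈V x∉B x~B B = record
    { ⊆V     = ∪-lub (x∈p⇒⁅x⁆⊆p x∈V) (⊆V B)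
    ; clique = ⁅x⁆∪-IsClique (clique B) x~B
    ; size   = trans (∣⁅x⁆∪p∣≡1+∣p∣ x∉B) (cong suc (size B))
    }

  KClique-avoiding : ∀ {V k T w} → w ∉ T → KClique V k T → KClique (V - w) k T
  KClique-avoiding w∉T T = record
    { ⊆V     = λ x∈T → x∈p∧x≢y⇒x∈p-y (⊆V T x∈T) λ { refl → w∉T x∈T }
    ; clique = clique T
    ; size   = size T
    }

  KClique-remove : ∀ {V k T w} → w ∈ T → KClique V (suc k) T → KClique (neighbours V w) k (T - w)
  KClique-remove {T = T} {w} w∈T T-clique = record
    { ⊆V     = λ x∈ → let x∈T = p─q⊆p T ⁅ w ⁆ x∈ ; x≢w = x∈p-y⇒x≢y x∈ in
                      x∈p∩q⁺ ( x∈p∧x≢y⇒x∈p-y (⊆V T-clique x∈T) x≢w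
                             , ∈-select⁺ (w ~?_) (clique T-clique w _ w∈T x∈T λ { refl → x≢w refl }))
    ; clique = λ x y x∈ y∈ → clique T-clique x y (p─q⊆p T ⁅ w ⁆ x∈) (p─q⊆p T ⁅ w ⁆ y∈)
    ; size   = suc-injective (trans (sym (∣p∣≡1+∣p-x∣ w∈T)) (size T-clique))
    }

  cliques : List (Fin n) → Subset n → ℕ → List (Subset n)
  cliques _        V zero    = ⊥ ∷ []
  cliques []       V (suc k) = []
  cliques (w ∷ ws) V (suc k) with w ∈? V
  ... | yes _ = cliques ws (V - w) (suc k) ++ map (⁅ w ⁆ ∪_) (cliques ws (neighbours V w) k)
  ... | no _  = cliques ws V (suc k)

  cliques-sound : ∀ ws V k {B} → B ∈L cliques ws V k → KClique V k B
  cliques-sound _ V zero (here refl) =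
    record { ⊆V = ⊥⊆ ; clique = λ _ _ x∈⊥ → contradiction x∈⊥ ∉⊥ ; size = ∣⊥∣≡0 n }
  cliques-sound (w ∷ ws) V (suc k) B∈ with w ∈? V
  ... | no _ = cliques-sound ws V (suc k) B∈
  ... | yes w∈V with ∈-++⁻ (cliques ws (V - w) (suc k)) B∈
  ...   | inj₁ B∈₁ = KClique-mono (p─q⊆p V ⁅ w ⁆) (cliques-sound ws (V - w) (suc k) B∈₁)
  ...   | inj₂ B∈₂ with ∈-map⁻ (⁅ w ⁆ ∪_) B∈₂
  ...     | B , B∈ , refl =
    let B-clique = cliques-sound ws (neighbours V w) k B∈ in
    KClique-extend w∈V (λ w∈B → w∉neighbours (⊆V B-clique w∈B))
                   (λ y y∈B → ∈-select⁻ (w ~?_) (p∩q⊆q _ _ (⊆V B-clique y∈B)))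
                   (KClique-mono neighbours⊆V B-clique)

  Covers : Subset n → List (Fin n) → Set
  Covers V ws = ∀ {x} → x ∈ V → x ∈L ws

  Covers-tail : ∀ {V V′ w ws} → Covers V (w ∷ ws) → V′ ⊆ V → w ∉ V′ → Covers V′ ws
  Covers-tail covers V′⊆V w∉V′ x∈V′ with covers (V′⊆V x∈V′)
  ... | here refl  = contradiction x∈V′ w∉V′
  ... | there x∈ws = x∈ws

  cliques-complete : ∀ ws V k {T} → Covers V ws → KClique V k T → T ∈L cliques ws V k
  cliques-complete _ V zero _ T-clique = here (∣p∣≡0⇒p≡⊥ (size T-clique))
  cliques-complete [] V (suc k) covers T-clique with ∣p∣≡1+k⇒Nonempty (size T-clique)
  ... | x , x∈T with covers (⊆V T-clique x∈T)
  ...   | ()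
  cliques-complete (w ∷ ws) V (suc k) {T} covers T-clique with w ∈? V
  ... | no w∉V = cliques-complete ws V (suc k) (Covers-tail covers id w∉V) T-clique
  ... | yes w∈V with w ∈? T
  ...   | no w∉T = ∈-++⁺ˡ (cliques-complete ws (V - w) (suc k)
                     (Covers-tail covers (p─q⊆p V ⁅ w ⁆) x∉p-x) (KClique-avoiding w∉T T-clique))
  ...   | yes w∈T = ∈-++⁺ʳ (cliques ws (V - w) (suc k))
                     (subst (_∈L map (⁅ w ⁆ ∪_) (cliques ws (neighbours V w) k)) (⁅x⁆∪[p-x]≡p w∈T)
                       (∈-map⁺ (⁅ w ⁆ ∪_) (cliques-complete ws (neighbours V w) k
                         (Covers-tail covers neighbours⊆V w∉neighbours)
                         (KClique-remove w∈T T-clique))))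

  cliques-unique : ∀ ws V k → Unique (cliques ws V k)
  cliques-unique _        V zero    = [] ∷ []
  cliques-unique []       V (suc k) = []
  cliques-unique (w ∷ ws) V (suc k) with w ∈? V
  ... | no _  = cliques-unique ws V (suc k)
  ... | yes _ = Unique.++⁺ (cliques-unique ws (V - w) (suc k))
      (Unique-map⁺-on {P = λ B → Empty (B ∩ ⁅ w ⁆)} (⁅ w ⁆ ∪_) (∪-cancelˡ ⁅ w ⁆)
         (All.tabulate λ B∈ → x∉p⇒Empty[p∩⁅x⁆] λ w∈B →
            w∉neighbours (⊆V (cliques-sound ws (neighbours V w) k B∈) w∈B))
         (cliques-unique ws (neighbours V w) k))
      λ (X∈₁ , X∈₂) → case ∈-map⁻ (⁅ w ⁆ ∪_) X∈₂ of λ where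
        (B , _ , refl) → x∉p-x (⊆V (cliques-sound ws (V - w) (suc k) X∈₁) (p⊆p∪q B (x∈⁅x⁆ w)))

  -- apex: at least k − 1 vertices (or all of V) adjacent to all of V, listed after the other vertices
  -- of V. It lets every (k − 1)-clique of V not covering V grow to a k-clique (extend-or-cover),
  -- which keeps the deletion of each shed vertex pure.
  record ConeOrdered (ws : List (Fin n)) (V : Subset n) (k : ℕ) : Set where
    constructor mkConeOrdered
    field
      covers        : Covers V ws
      apex          : Subset n
      others apexes : List (Fin n)
      ordered       : ws ≡ others ++ apexes
      apex⊆V        : apex ⊆ V
      apex-adjacent : ∀ {h x} → h ∈ apex → x ∈ V → h ≢ x → h ~ x
      apex-large    : k ≤ suc ∣ apex ∣ ⊎ V ⊆ apex
      others∉apex   : ∀ {x} → x ∈L others → x ∉ apex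
      apexes∈apex   : ∀ {x} → x ∈ V → x ∈L apexes → x ∈ apex

  open ConeOrdered

  ConeOrdered-tail : ∀ {w ws V V′ k k′} → ConeOrdered (w ∷ ws) V k → V′ ⊆ V → w ∉ V′ → k′ ≤ k →
    (∀ {x} → x ∈ V → x ≢ w → (∀ {y} → y ∈ V → x ≢ y → x ~ y) → x ∈ V′) → ConeOrdered ws V′ k′
  ConeOrdered-tail {V′ = V′} (mkConeOrdered covers U [] _ refl _ U-adjacent _ _ apexes∈U)
                   V′⊆V w∉V′ _ _ =
    mkConeOrdered (Covers-tail covers V′⊆V w∉V′) V′ [] _ refl id
      (λ h∈V′ x∈V′ → U-adjacent (apexes∈U (V′⊆V h∈V′) (covers (V′⊆V h∈V′))) (V′⊆V x∈V′))
      (inj₂ id) (λ ()) (λ x∈V′ _ → x∈V′)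
  ConeOrdered-tail {V′ = V′}
    (mkConeOrdered covers U (_ ∷ others) apexes refl U⊆V U-adjacent U-large others∉U apexes∈U)
    V′⊆V w∉V′ k′≤k keeps =
    mkConeOrdered (Covers-tail covers V′⊆V w∉V′) U others apexes refl U⊆V′
      (λ h∈U x∈V′ → U-adjacent h∈U (V′⊆V x∈V′)) large
      (λ x∈ → others∉U (there x∈)) (λ x∈V′ → apexes∈U (V′⊆V x∈V′))
    where
    U⊆V′ : U ⊆ V′
    U⊆V′ h∈U = keeps (U⊆V h∈U) (λ { refl → others∉U (here refl) h∈U }) (U-adjacent h∈U)
    large : _ ≤ suc ∣ U ∣ ⊎ V′ ⊆ U
    large = Sum.map (≤-trans k′≤k) (λ V⊆U {x} x∈V′ → V⊆U (V′⊆V x∈V′)) U-large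

  extend-or-cover : ∀ {ws V k B} → ConeOrdered ws V (suc k) → KClique V k B →
    (∃ λ x → x ∈ V × x ∉ B × ∀ y → y ∈ B → x ~ y) ⊎ V ⊆ B
  extend-or-cover {B = B} co B-clique with apex co ⊆? B
  ... | no U⊈B =
    let h , h∈U , h∉B = ⊈⇒∃∉ U⊈B in
    inj₁ (h , apex⊆V co h∈U , h∉B , λ y y∈B →
      apex-adjacent co h∈U (⊆V B-clique y∈B) λ { refl → h∉B y∈B })
  ... | yes U⊆B with _ ⊆? B
  ...   | yes V⊆B = inj₂ V⊆B
  ...   | no V⊈B  =
    let x , x∈V , x∉B = ⊈⇒∃∉ V⊈B in
    inj₁ (x , x∈V , x∉B , λ y y∈B → ~-sym (apex-adjacent co (B⊆U y∈B) x∈V λ { refl → x∉B y∈B }))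
    where
    B⊆U : B ⊆ apex co
    B⊆U with apex-large co
    ... | inj₁ 1+k≤ =
      ⊆-reflexive (sym (p⊆q∧∣q∣≤∣p∣⇒p≡q U⊆B (subst (_≤ _) (sym (size B-clique)) (≤-pred 1+k≤))))
    ... | inj₂ V⊆U  = λ y∈B → V⊆U (⊆V B-clique y∈B)

  cliques-prefixDecomposable : ∀ {m} ws V k → ConeOrdered ws V k →
                               PrefixDecomposable m ⟨_⟩ (cliques ws V k)
  cliques-prefixDecomposable _ V zero _ 1 _ _ = simplex (⟨⟩-simplex (here refl) (refl ∷ []))
  cliques-prefixDecomposable _ V zero _ (suc (suc _)) _ (s≤s ())
  cliques-prefixDecomposable [] V (suc k) _ (suc _) _ ()
  cliques-prefixDecomposable (w ∷ ws) V (suc k) co with w ∈? V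
  ... | no w∉V =
    cliques-prefixDecomposable ws V (suc k) (ConeOrdered-tail co id w∉V ≤-refl (λ x∈V _ _ → x∈V))
  ... | yes w∈V = PrefixDecomposable-++-cone w Q₁ Q₂ Q₁-avoids Q₂-avoids extends unique
                    (cliques-prefixDecomposable ws V₁ (suc k) co₁)
                    (cliques-prefixDecomposable ws V₂ k co₂)
    where
    V₁ V₂ : Subset n
    V₁ = V - w
    V₂ = neighbours V w
    Q₁ Q₂ : List (Subset n)
    Q₁ = cliques ws V₁ (suc k)
    Q₂ = cliques ws V₂ k

    co₁ : ConeOrdered ws V₁ (suc k)
    co₁ = ConeOrdered-tail co (p─q⊆p V ⁅ w ⁆) x∉p-x ≤-refl (λ x∈V x≢w _ → x∈p∧x≢y⇒x∈p-y x∈V x≢w)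

    co₂ : ConeOrdered ws V₂ k
    co₂ = ConeOrdered-tail co neighbours⊆V w∉neighbours (n≤1+n k)
            λ x∈V x≢w x~V → x∈p∩q⁺ ( x∈p∧x≢y⇒x∈p-y x∈V x≢w
                                    , ∈-select⁺ (w ~?_) (~-sym (x~V w∈V x≢w)))

    Q₁-avoids : ∀ {A} → A ∈L Q₁ → w ∉ A × ∣ A ∣ ≡ suc k
    Q₁-avoids A∈ = let A-clique = cliques-sound ws V₁ (suc k) A∈ in
      (λ w∈A → x∉p-x (⊆V A-clique w∈A)) , size A-clique

    Q₂-avoids : ∀ {B} → B ∈L Q₂ → w ∉ B × ∣ B ∣ ≡ k
    Q₂-avoids B∈ = let B-clique = cliques-sound ws V₂ k B∈ in
      (λ w∈B → w∉neighbours (⊆V B-clique w∈B)) , size B-clique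

    extended-or-covering : ∀ {B} → B ∈L Q₂ → ⟨ Q₁ ⟩ B ⊎ V₁ ⊆ B
    extended-or-covering {B} B∈ =
      Sum.map₁ (λ (x , x∈V₁ , x∉B , x~B) →
                  lose (cliques-complete ws V₁ (suc k) (covers co₁)
                                         (KClique-extend x∈V₁ x∉B x~B B-clique))
                       (q⊆p∪q ⁅ x ⁆ B))
               (extend-or-cover co₁ B-clique)
      where
      B-clique : KClique V₁ k B
      B-clique = KClique-mono (p∩q⊆p _ _) (cliques-sound ws V₂ k B∈)

    extends : ∀ {A B} → A ∈L Q₁ → B ∈L Q₂ → ⟨ Q₁ ⟩ B
    extends A∈ B∈ with extended-or-covering B∈
    ... | inj₁ B∈⟨Q₁⟩ = B∈⟨Q₁⟩
    ... | inj₂ V₁⊆B   = contradiction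
      (subst₂ _≤_ (size A-clique) (proj₂ (Q₂-avoids B∈))
                  (p⊆q⇒∣p∣≤∣q∣ (λ x∈A → V₁⊆B (⊆V A-clique x∈A))))
      (n≮n k)
      where A-clique = cliques-sound ws V₁ (suc k) A∈

    unique : Q₁ ≡ [] → ∀ {B B′} → B ∈L Q₂ → B′ ∈L Q₂ → B ≡ B′
    unique Q₁≡[] {B} {B′} B∈ B′∈ with extended-or-covering B∈
    ... | inj₁ B∈⟨Q₁⟩ = case subst (λ Q → ⟨ Q ⟩ B) Q₁≡[] B∈⟨Q₁⟩ of λ ()
    ... | inj₂ V₁⊆B   = sym (p⊆q∧∣q∣≤∣p∣⇒p≡q
      (λ x∈B′ → V₁⊆B (p∩q⊆p _ _ (⊆V (cliques-sound ws V₂ k B′∈) x∈B′)))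
      (≤-reflexive (trans (proj₂ (Q₂-avoids B∈)) (sym (proj₂ (Q₂-avoids B′∈))))))

-- The new facets of full^d(skel C + e)

module NewFacets {n} (k : ℕ) (C : Cx n) (isC : IsComplex C) (C? : ∀ F → Dec (C F))
  (pureC : Pure (2 + k) C) (H : Subset n) (coned : FullyConed (2 + k) C H) (k≤∣H∣ : k ≤ ∣ H ∣)
  (u v : Fin n) (u∈C : Vertex C u) (v∈C : Vertex C v) (u≢v : u ≢ v) (e∉C : ¬ C (edge u v)) where

  d : ℕ
  d = 2 + k

  e : Subset n
  e = edge u v

  _~_ : Fin n → Fin n → Set
  _~_ = adj (skel C)

  _~?_ : ∀ x y → Dec (x ~ y)
  x ~? y = ¬? (x ≟ᶠ y) ×-dec C? (edge x y)

  ~-sym : ∀ {x y} → x ~ y → y ~ x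
  ~-sym {x} {y} (x≢y , xy∈C) = (λ y≡x → x≢y (sym y≡x)) , subst C (∪-comm ⁅ x ⁆ ⁅ y ⁆) xy∈C

  open Cliques _~_ _~?_ ~-sym
  open KClique

  H-adjacent : ∀ {h x} → h ∈ H → Vertex C x → h ≢ x → h ~ x
  H-adjacent h∈H x∈C h≢x = h≢x , proj₂ (proj₁ coned _ h∈H) _ x∈C h≢x

  e-vertex : ∀ {z} → z ∈ e → Vertex C z
  e-vertex z∈e with x∈edge⁻ z∈e
  ... | inj₁ refl = u∈C
  ... | inj₂ refl = v∈C

  e∌H : ∀ {z} → z ∈ e → z ∉ H
  e∌H z∈e z∈H with x∈edge⁻ z∈e
  ... | inj₁ refl = e∉C (proj₂ (H-adjacent z∈H v∈C u≢v))
  ... | inj₂ refl = e∉C (proj₂ (~-sym (H-adjacent z∈H u∈C λ { refl → u≢v refl })))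

  V₀ : Subset n
  V₀ = N u ∩ N v

  V₀-adjacent : ∀ {z x} → z ∈ e → x ∈ V₀ → z ~ x
  V₀-adjacent {z} z∈e x∈V₀ with x∈edge⁻ z∈e
  ... | inj₁ refl = ∈-select⁻ (z ~?_) (p∩q⊆p _ _ x∈V₀)
  ... | inj₂ refl = ∈-select⁻ (z ~?_) (p∩q⊆q _ _ x∈V₀)

  V₀-vertex : ∀ {x} → x ∈ V₀ → Vertex C x
  V₀-vertex x∈V₀ = vertex-of-face isC (proj₂ (V₀-adjacent u∈edge x∈V₀)) v∈edge

  V₀∌e : ∀ {x} → x ∈ V₀ → x ∉ e
  V₀∌e x∈V₀ x∈e = proj₁ (V₀-adjacent x∈e x∈V₀) refl

  H⊆V₀ : H ⊆ V₀
  H⊆V₀ h∈H = x∈p∩q⁺ (∈-select⁺ (u ~?_) (adjacent u∈C u∈edge) , ∈-select⁺ (v ~?_) (adjacent v∈C v∈edge))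
    where
    adjacent : ∀ {z} → Vertex C z → z ∈ e → z ~ _
    adjacent z∈C z∈e = ~-sym (H-adjacent h∈H z∈C λ { refl → e∌H z∈e h∈H })

  extension-face : ∀ {K x} → Clique (skel C) K → ∣ K ∣ ≡ d → x ∉ K → Vertex C x →
                   (∀ y → y ∈ K → x ~ y) → C K
  extension-face {K} {x} (vertices , clique) size x∉K x∈C x~K =
    isC (⁅ x ⁆ ∪ K) K (q⊆p∪q ⁅ x ⁆ K)
      (proj₁ (proj₂ coned (⁅ x ⁆ ∪ K) (vertices′ , ⁅x⁆∪-IsClique clique x~K)
                                      (trans (∣⁅x⁆∪p∣≡1+∣p∣ x∉K) (cong suc size))))
    where
    vertices′ : ∀ y → y ∈ ⁅ x ⁆ ∪ K → Vertex C y
    vertices′ y y∈ with x∈⁅y⁆∪p⁻ x K y∈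
    ... | inj₁ refl = x∈C
    ... | inj₂ y∈K  = vertices y y∈K

  small-clique-face : ∀ {R z} → Clique (skel C) R → z ∈ R → ∣ R ∣ ≤ 2 → C R
  small-clique-face {R} {z} (vertices , clique) z∈R ∣R∣≤2 with R ⊆? ⁅ z ⁆
  ... | yes R⊆z = isC ⁅ z ⁆ R R⊆z (vertices z z∈R)
  ... | no R⊈z with ⊈⇒∃∉ R⊈z
  ...   | y , y∈R , y∉z = subst C zy≡R (proj₂ (clique z y z∈R y∈R z≢y))
    where
    z≢y : z ≢ y
    z≢y refl = y∉z (x∈⁅x⁆ z)
    zy≡R : edge z y ≡ R
    zy≡R = p⊆q∧∣q∣≤∣p∣⇒p≡q (∪-lub (x∈p⇒⁅x⁆⊆p z∈R) (x∈p⇒⁅x⁆⊆p y∈R))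
                           (subst (∣ R ∣ ≤_) (sym (∣edge∣≡2 z≢y)) ∣R∣≤2)

  extension-through-face : ∀ {K} → Clique (skel C) K → ∣ K ∣ ≡ d → C (K ─ H) → C K
  extension-through-face {K} K-clique size K─H∈C with facet-above isC C? K─H∈C
  ... | T , T-facet , K─H⊆T
    with ∣p∣<∣q∣⇒∃∈q∉p {p = K} {T} (subst₂ _<_ (sym size) (sym (pureC T T-facet)) ≤-refl)
  ...   | x , x∈T , x∉K = extension-face K-clique size x∉K (vertex-of-face isC T∈C x∈T) x~K
    where
    T∈C : C T
    T∈C = proj₁ T-facet
    x~K : ∀ y → y ∈ K → x ~ y
    x~K y y∈K with y ∈? H
    ... | yes y∈H = ~-sym (H-adjacent y∈H (vertex-of-face isC T∈C x∈T) λ { refl → x∉K y∈K })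
    ... | no y∉H  = (λ { refl → x∉K y∈K }) , edge-of-face isC T∈C x∈T (K─H⊆T (x∈p∧x∉q⇒x∈p─q y∈K y∉H))

  -- Either a vertex of H outside K is adjacent to all of K, or H ⊆ K: then ∣ H ∣ ≥ d − 2 leaves at
  -- most two vertices in K ─ H, so K ─ H is a face, and a facet through it has a vertex adjacent
  -- to all of K.
  clique-face : ∀ {K z} → Clique (skel C) K → ∣ K ∣ ≡ d → z ∈ K → z ∉ H → C K
  clique-face {K} K-clique size z∈K z∉H with H ⊆? K
  ... | no H⊈K =
    let h , h∈H , h∉K = ⊈⇒∃∉ H⊈K in
    extension-face K-clique size h∉K (proj₁ (proj₁ coned h h∈H))
      λ y y∈K → H-adjacent h∈H (proj₁ K-clique y y∈K) λ { refl → h∉K y∈K }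
  ... | yes H⊆K = extension-through-face K-clique size
    (small-clique-face (Clique-⊆ (p─q⊆p K H) K-clique) (x∈p∧x∉q⇒x∈p─q z∈K z∉H) ∣K─H∣≤2)
    where
    open ≤-Reasoning
    ∣H∣≤∣K∩H∣ : ∣ H ∣ ≤ ∣ K ∩ H ∣
    ∣H∣≤∣K∩H∣ = p⊆q⇒∣p∣≤∣q∣ λ x∈H → x∈p∩q⁺ (H⊆K x∈H , x∈H)
    ∣K─H∣≤2 : ∣ K ─ H ∣ ≤ 2
    ∣K─H∣≤2 = +-cancelʳ-≤ k ∣ K ─ H ∣ 2 (begin
      ∣ K ─ H ∣ + k         ≤⟨ +-monoʳ-≤ ∣ K ─ H ∣ (≤-trans k≤∣H∣ ∣H∣≤∣K∩H∣) ⟩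
      ∣ K ─ H ∣ + ∣ K ∩ H ∣ ≡⟨ ∣p∣≡∣p─q∣+∣p∩q∣ K H ⟨
      ∣ K ∣                 ≡⟨ size ⟩
      2 + k                 ∎)

  endpoint-face : ∀ {z A} → z ∈ e → KClique V₀ (suc k) A → C (⁅ z ⁆ ∪ A)
  endpoint-face {z} {A} z∈e A-clique =
    clique-face
      (vertices , ⁅x⁆∪-IsClique (clique A-clique) λ y y∈A → V₀-adjacent z∈e (⊆V A-clique y∈A))
      (trans (∣⁅x⁆∪p∣≡1+∣p∣ λ z∈A → V₀∌e (⊆V A-clique z∈A) z∈e) (cong suc (size A-clique)))
      (p⊆p∪q A (x∈⁅x⁆ z)) (e∌H z∈e)
    where
    vertices : ∀ y → y ∈ ⁅ z ⁆ ∪ A → Vertex C y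
    vertices y y∈ with x∈⁅y⁆∪p⁻ z A y∈
    ... | inj₁ refl = e-vertex z∈e
    ... | inj₂ y∈A  = V₀-vertex (⊆V A-clique y∈A)

  ⊆⁅endpoint⁆∪ : ∀ {A G z} → G ⊆ e ∪ A → (∀ {x} → x ∈ G → x ∈ e → x ≡ z) → G ⊆ ⁅ z ⁆ ∪ A
  ⊆⁅endpoint⁆∪ {A} {G} {z} G⊆e∪A only-z {x} x∈G with x∈p∪q⁻ e A (G⊆e∪A x∈G)
  ... | inj₁ x∈e = subst (_∈ ⁅ z ⁆ ∪ A) (sym (only-z x∈G x∈e)) (p⊆p∪q A (x∈⁅x⁆ z))
  ... | inj₂ x∈A = q⊆p∪q ⁅ z ⁆ A x∈A

  new-facet-faces : ∀ {A G} → KClique V₀ (suc k) A → G ⊆ e ∪ A → ¬ e ⊆ G → C G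
  new-facet-faces {A} {G} A-clique G⊆e∪A e⊈G with u ∈? G | v ∈? G
  ... | yes u∈G | yes v∈G = ⊥-elim (e⊈G (∪-lub (x∈p⇒⁅x⁆⊆p u∈G) (x∈p⇒⁅x⁆⊆p v∈G)))
  ... | no u∉G  | _       = isC _ G (⊆⁅endpoint⁆∪ G⊆e∪A only-v) (endpoint-face v∈edge A-clique)
    where
    only-v : ∀ {x} → x ∈ G → x ∈ e → x ≡ v
    only-v x∈G x∈e with x∈edge⁻ x∈e
    ... | inj₁ refl = contradiction x∈G u∉G
    ... | inj₂ x≡v  = x≡v
  ... | yes _   | no v∉G  = isC _ G (⊆⁅endpoint⁆∪ G⊆e∪A only-u) (endpoint-face u∈edge A-clique)
    where
    only-u : ∀ {x} → x ∈ G → x ∈ e → x ≡ u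
    only-u x∈G x∈e with x∈edge⁻ x∈e
    ... | inj₁ x≡u  = x≡u
    ... | inj₂ refl = contradiction x∈G v∉G

  outside-H inside-H order : List (Fin n)
  outside-H = filter (λ x → ¬? (x ∈? H)) (allFin n)
  inside-H  = filter (_∈? H) (allFin n)
  order     = outside-H ++ inside-H

  order-covers : Covers V₀ order
  order-covers {x} _ with x ∈? H
  ... | yes x∈H = ∈-++⁺ʳ outside-H (∈-filter⁺ (_∈? H) (∈-allFin x) x∈H)
  ... | no x∉H  = ∈-++⁺ˡ (∈-filter⁺ (λ x → ¬? (x ∈? H)) (∈-allFin x) x∉H)

  order-coneOrdered : ConeOrdered order V₀ (suc k)
  order-coneOrdered = mkConeOrdered order-covers H outside-H inside-H refl H⊆V₀
    (λ h∈H x∈V₀ → H-adjacent h∈H (V₀-vertex x∈V₀)) (inj₁ (s≤s k≤∣H∣))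
    (λ x∈ → proj₂ (∈-filter⁻ (λ x → ¬? (x ∈? H)) {xs = allFin n} x∈))
    (λ _ x∈ → proj₂ (∈-filter⁻ (_∈? H) {xs = allFin n} x∈))

  Q₀ newFacets : List (Subset n)
  Q₀        = cliques order V₀ (suc k)
  newFacets = map (e ∪_) Q₀

  Q₀-cliques : ∀ {A} → A ∈L Q₀ → KClique V₀ (suc k) A
  Q₀-cliques = cliques-sound order V₀ (suc k)

  V₀-disjoint : ∀ {A} → A ⊆ V₀ → Empty (A ∩ e)
  V₀-disjoint A⊆V₀ (x , x∈) = let x∈A , x∈e = x∈p∩q⁻ _ e x∈ in V₀∌e (A⊆V₀ x∈A) x∈e

  ∣e∪A∣≡2+∣A∣ : ∀ {A} → Empty (A ∩ e) → ∣ e ∪ A ∣ ≡ 2 + ∣ A ∣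
  ∣e∪A∣≡2+∣A∣ {A} A∩e=∅ = trans (∣p∪q∣≡∣p∣+∣q∣ e A (Empty-∩-comm A∩e=∅)) (cong (_+ ∣ A ∣) (∣edge∣≡2 u≢v))

  new-facet-size : ∀ {A} → KClique V₀ (suc k) A → ∣ e ∪ A ∣ ≡ suc d
  new-facet-size A-clique = trans (∣e∪A∣≡2+∣A∣ (V₀-disjoint (⊆V A-clique))) (cong (2 +_) (size A-clique))

  newFacets-unique : Unique newFacets
  newFacets-unique =
    Unique-map⁺-on {P = λ A → Empty (A ∩ e)} (e ∪_) (∪-cancelˡ e)
      (All.tabulate λ A∈ → V₀-disjoint (⊆V (Q₀-cliques A∈))) (cliques-unique order V₀ (suc k))

  G′ : Graph n
  G′ = addEdge (skel C) u v

  e∪A-clique : ∀ {A} → KClique V₀ (suc k) A → Clique G′ (e ∪ A)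
  e∪A-clique {A} A-clique = vertices , adjacent
    where
    vertices : ∀ x → x ∈ e ∪ A → Vertex C x
    vertices x x∈ with x∈p∪q⁻ e A x∈
    ... | inj₁ x∈e = e-vertex x∈e
    ... | inj₂ x∈A = V₀-vertex (⊆V A-clique x∈A)
    adjacent : ∀ x y → x ∈ e ∪ A → y ∈ e ∪ A → x ≢ y → adj G′ x y
    adjacent x y x∈ y∈ x≢y with x∈p∪q⁻ e A x∈ | x∈p∪q⁻ e A y∈
    ... | inj₁ x∈e | inj₂ y∈A = inj₁ (V₀-adjacent x∈e (⊆V A-clique y∈A))
    ... | inj₂ x∈A | inj₁ y∈e = inj₁ (~-sym (V₀-adjacent y∈e (⊆V A-clique x∈A)))
    ... | inj₂ x∈A | inj₂ y∈A = inj₁ (clique A-clique x y x∈A y∈A x≢y)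
    ... | inj₁ x∈e | inj₁ y∈e with x∈edge⁻ x∈e | x∈edge⁻ y∈e
    ...   | inj₁ refl | inj₂ refl = inj₂ (inj₁ (refl , refl))
    ...   | inj₂ refl | inj₁ refl = inj₂ (inj₂ (refl , refl))
    ...   | inj₁ refl | inj₁ refl = contradiction refl x≢y
    ...   | inj₂ refl | inj₂ refl = contradiction refl x≢y

  newFacets-sound : ∀ {S} → S ∈L newFacets → Facet (full d G′) S × ¬ C S
  newFacets-sound S∈ with ∈-map⁻ (e ∪_) S∈
  ... | A , A∈ , refl =
    full-facet (e∪A-clique (Q₀-cliques A∈)) (new-facet-size (Q₀-cliques A∈)) ,
    λ e∪A∈C → e∉C (isC _ e (p⊆p∪q A) e∪A∈C)

  e⊆new-facet : ∀ {S} → Clique G′ S → ∣ S ∣ ≡ suc d → ¬ C S → e ⊆ S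
  e⊆new-facet {S} S-clique size S∉C with e ⊆? S
  ... | yes e⊆S = e⊆S
  ... | no e⊈S  = ⊥-elim (S∉C (proj₁ (proj₂ coned S (Clique-addEdge⁻ S-clique not-both) size)))
    where
    not-both : ¬ (u ∈ S × v ∈ S)
    not-both (u∈S , v∈S) = e⊈S (∪-lub (x∈p⇒⁅x⁆⊆p u∈S) (x∈p⇒⁅x⁆⊆p v∈S))

  new-facet─e : ∀ {S} → Clique G′ S → ∣ S ∣ ≡ suc d → e ⊆ S → KClique V₀ (suc k) (S ─ e)
  new-facet─e {S} (_ , adjacent) size e⊆S = record
    { ⊆V     = λ x∈ → x∈p∩q⁺ ( ∈-select⁺ (u ~?_) (endpoint-adjacent u∈edge x∈)
                             , ∈-select⁺ (v ~?_) (endpoint-adjacent v∈edge x∈))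
    ; clique = λ x y x∈ y∈ x≢y →
        adj-addEdge⁻ {G = skel C} (adjacent x y (p─q⊆p S e x∈) (p─q⊆p S e y∈) x≢y) (inj₁ (x∈p─q⇒x∉q S e x∈))
    ; size   = suc-injective (suc-injective (begin
        2 + ∣ S ─ e ∣       ≡⟨ ∣e∪A∣≡2+∣A∣ (Empty[p─q∩q] S e) ⟨
        ∣ e ∪ (S ─ e) ∣     ≡⟨ cong ∣_∣ (p⊆q⇒p∪[q─p]≡q e⊆S) ⟩
        ∣ S ∣               ≡⟨ size ⟩
        suc d               ∎))
    }
    where
    open ≡-Reasoning
    endpoint-adjacent : ∀ {z x} → z ∈ e → x ∈ S ─ e → z ~ x
    endpoint-adjacent z∈e x∈ = adj-addEdge⁻ {G = skel C}
      (adjacent _ _ (e⊆S z∈e) (p─q⊆p S e x∈) λ { refl → x∈p─q⇒x∉q S e x∈ z∈e })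
      (inj₂ (x∈p─q⇒x∉q S e x∈))

  newFacets-complete : ∀ {S} → Facet (full d G′) S × ¬ C S → S ∈L newFacets
  newFacets-complete {S} (S-facet , S∉C) =
    let S-clique , size = full-facet⁻ S-facet
        e⊆S = e⊆new-facet S-clique size S∉C
    in subst (_∈L newFacets) (p⊆q⇒p∪[q─p]≡q e⊆S)
         (∈-map⁺ (e ∪_) (cliques-complete order V₀ (suc k) order-covers
                                           (new-facet─e S-clique size e⊆S)))

  newFacets-prefixDecomposable : ∀ {m} → Decomp (suc m) C → PrefixDecomposable (suc m) (Gen C) newFacets
  newFacets-prefixDecomposable {m} decC =
    PrefixDecomposable-map {K = ⟨_⟩} {K′ = Gen C} (λ P A₀∈ ⊆Q₀ →
      Decomp-cone e C P (λ G∈C e⊆G → e∉C (isC _ e e⊆G G∈C)) (u , u∈edge)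
        (subst (_≤ 2 + m) (sym (∣edge∣≡2 u≢v)) (s≤s (s≤s z≤n))) A₀∈
        (λ A∈ → new-facet-faces (Q₀-cliques (⊆Q₀ A∈)))
        (All.tabulate λ A∈ → V₀-disjoint (⊆V (Q₀-cliques (⊆Q₀ A∈))))
        (All.tabulate λ A∈ → new-facet-size (Q₀-cliques (⊆Q₀ A∈)))
        pureC decC)
      (cliques-prefixDecomposable order V₀ (suc k) order-coneOrdered)

lemma4p5 : ∀ {n : ℕ} (d : ℕ) → 2 ≤ d →
    (C : Cx n) → IsComplex C → (∀ F → Dec (C F)) → Pure d C → Decomp 1 C →
    (H : Subset n) → FullyConed d C H → d ∸ 2 ≤ ∣ H ∣ →
    (u v : Fin n) → Vertex C u → Vertex C v → u ≢ v → ¬ C (edge u v) →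
    (Σ (Subset n) λ S → Clique (addEdge (skel C) u v) S × ∣ S ∣ ≡ suc d × u ∈ S × v ∈ S) →
    Σ (List (Subset n)) λ Fs →
      Unique Fs ×
      (∀ S → (S ∈L Fs) ⇔ (Facet (full d (addEdge (skel C) u v)) S × ¬ C S)) ×
      (∀ i → 1 ≤ i → i ≤ length Fs → Decomp 1 (Gen C (take i Fs)))
lemma4p5 (suc (suc k)) (s≤s (s≤s z≤n)) C isC C? pureC decC H coned k≤∣H∣ u v u∈C v∈C u≢v e∉C _ =
  newFacets , newFacets-unique , (λ S → mk⇔ newFacets-sound newFacets-complete) ,
  newFacets-prefixDecomposable decC
  where open NewFacets k C isC C? pureC H coned k≤∣H∣ u v u∈C v∈C u≢v e∉C
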